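{- Let $n\geqslant 2$ and $t\geqslant 0$ be integers. Then the set of all matrices $A\in\mathcal{A}(n,2)$ with $\nu(A)=t$ is an antichain in the Bruhat order of $\mathcal{A}(n,2)$ (i.e., any two distinct such matrices are incomparable; the set may be empty).
   Context: $\mathcal{A}(n,k)$ denotes the class of all $n\times n$ matrices with entries in $\{0,1\}$ in which every row and every column sums to $k$. For an $m\times n$ $(0,1)$-matrix $A=[a_{ij}]$ let $\sigma_{ij}(A)=\sum_{k=1}^{i}\sum_{\ell=1}^{j}a_{k\ell}$. For $A,C$ in the same class, $A\preceq_B C$ (Bruhat order) iff $\sigma_{ij}(A)\geqslant\sigma_{ij}(C)$ for all $i,j$. An inversion in a $(0,1)$-matrix $A=[a_{ij}]$ is an unordered pair of entries $a_{ij},a_{k\ell}$ with $a_{ij}=a_{k\ell}=1$ and $(i-k)(j-\ell)<0$; $\nu(A)$ denotes the number of inversions of $A$. -}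

module Defs where

open import Data.Nat using (ℕ; zero; suc; _+_; _≥_; _<_)
open import Data.Bool using (Bool; true; false)
open import Data.Fin using (Fin; toℕ) renaming (_<_ to _<ᶠ_)
open import Data.Fin.Properties using (_<?_)
open import Relation.Nullary using (Dec; yes; no)
open import Relation.Binary.PropositionalEquality using (_≡_)

-- (0,1)-matrices of size m × n: entry true = 1, false = 0
Mat : ℕ → ℕ → Set
Mat m n = Fin m → Fin n → Bool

val : Bool → ℕ
val true  = 1
val false = 0

sumFin : (n : ℕ) → (Fin n → ℕ) → ℕ
sumFin zero    f = 0
sumFin (suc n) f = f Fin.zero + sumFin n (λ i → f (Fin.suc i))

ind : ∀ {P : Set} → Dec P → ℕ → ℕ
ind (yes _) x = x
ind (no _)  _ = 0

sumUpTo : (n : ℕ) → ℕ → (Fin n → ℕ) → ℕ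
sumUpTo n k f = sumFin n (λ i → ind (toℕ i Data.Nat.<? k) (f i))

rowSum : ∀ {m n} → Mat m n → Fin m → ℕ
rowSum {m} {n} A i = sumFin n (λ j → val (A i j))

colSum : ∀ {m n} → Mat m n → Fin n → ℕ
colSum {m} {n} A j = sumFin m (λ i → val (A i j))

InA : (n k : ℕ) → Mat n n → Set
InA n k A = (∀ i → rowSum A i ≡ k) × (∀ j → colSum A j ≡ k)
  where open import Data.Product using (_×_)

-- σ_ij(A) = Σ_{k ≤ i} Σ_{ℓ ≤ j} a_kℓ  (1-indexed i, j; we allow 0 ≤ i ≤ m, 0 ≤ j ≤ n,
-- the extra values i=0 or j=0 give σ = 0 for every matrix and add no constraint)
σ : ∀ {m n} → Mat m n → ℕ → ℕ → ℕ
σ {m} {n} A i j = sumUpTo m i (λ k → sumUpTo n j (λ l → val (A k l)))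

_⪯B_ : ∀ {m n} → Mat m n → Mat m n → Set
_⪯B_ {m} {n} A C = ∀ (i j : ℕ) → i Data.Nat.≤ m → j Data.Nat.≤ n → σ A i j ≥ σ C i j

both : Bool → Bool → Bool
both true true = true
both _    _    = false

-- ν(A): number of unordered pairs of 1-entries a_ij, a_kℓ with (i-k)(j-ℓ) < 0.
-- Each such unordered pair is counted once as the ordered pair with i < k and ℓ < j.
ν : ∀ {m n} → Mat m n → ℕ
ν {m} {n} A =
  sumFin m λ i → sumFin n λ j → sumFin m λ k → sumFin n λ l →
    ind (i <? k) (ind (l <? j) (val (both (A i j) (A k l))))

-- For (0,1)-matrices X, Y of the same shape let β X Y be the sum of w(i,k) w(j,l) over the
-- 1-entries (i,j) of X and (k,l) of Y, where w(i,k) is 2, 1 or 0 according as i <, =, > k.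
-- As w(i,k) = [i < k] + [i ≤ k], β X Y is the sum, over the 1-entries (k,l) of Y, of σ_X at
-- the four corners of the cell (k,l). Hence A ⪯B C gives β C Y ≤ β A Y for every Y, strictly
-- for Y = A: at the first entry (in row-major order) where A and C differ, A has the 1 and
-- σ_A exceeds σ_C. Since w(i,k) + w(k,i) = 2, β is symmetric on matrices with equal row and
-- column sums, and comparing each pair of 1-entries of X in both orders shows that
-- β X X + 4 ν(X) depends only on the row and column sums. So for A ≠ C in one class with
-- A ⪯B C we get β C C ≤ β A C = β C A < β A A, that is ν(A) < ν(C).

module Submission where

open import Defs
open import Data.Nat using (ℕ; zero; suc; _+_; _*_; _≤_; _<_; _≥_; z≤n; s≤s; s≤s⁻¹)
open import Data.Nat.Properties
open import Data.Nat.Tactic.RingSolver using (solve-∀)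
open import Data.Fin as Fin using (Fin; toℕ; fromℕ<)
import Data.Fin.Properties as Fin
open import Data.Bool using (Bool; true; false)
import Data.Bool.Properties as Bool
open import Data.Product using (∃; ∃₂; _×_; _,_; proj₁)
open import Function using (_∘_)
open import Relation.Nullary using (¬_; Dec; yes; no; contradiction)
open import Relation.Unary using (Pred; Decidable)
open import Relation.Binary using (tri<; tri≈; tri>)
open import Relation.Binary.PropositionalEquality
open import Algebra.Properties.Semiring.Sum +-*-semiring
  using (sum; sum-cong-≗; ∑-distrib-+; ∑-comm; *-distribˡ-sum)
open ≡-Reasoning

private
  variable
    m n : ℕ

sumFin≡sum : ∀ n (f : Fin n → ℕ) → sumFin n f ≡ sum f
sumFin≡sum zero    f = refl
sumFin≡sum (suc n) f = cong (f Fin.zero +_) (sumFin≡sum n (f ∘ Fin.suc))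

sumFin-cong : ∀ n {f g : Fin n → ℕ} → (∀ i → f i ≡ g i) → sumFin n f ≡ sumFin n g
sumFin-cong n {f} {g} f≗g = begin
  sumFin n f ≡⟨ sumFin≡sum n f ⟩
  sum f      ≡⟨ sum-cong-≗ f≗g ⟩
  sum g      ≡⟨ sumFin≡sum n g ⟨
  sumFin n g ∎

sumFin-+ : ∀ n (f g : Fin n → ℕ) → sumFin n (λ i → f i + g i) ≡ sumFin n f + sumFin n g
sumFin-+ n f g = begin
  sumFin n (λ i → f i + g i) ≡⟨ sumFin≡sum n _ ⟩
  sum (λ i → f i + g i)      ≡⟨ ∑-distrib-+ f g ⟩
  sum f + sum g              ≡⟨ cong₂ _+_ (sumFin≡sum n f) (sumFin≡sum n g) ⟨
  sumFin n f + sumFin n g    ∎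

sumFin-*ˡ : ∀ n c (f : Fin n → ℕ) → sumFin n (λ i → c * f i) ≡ c * sumFin n f
sumFin-*ˡ n c f = begin
  sumFin n (λ i → c * f i) ≡⟨ sumFin≡sum n _ ⟩
  sum (λ i → c * f i)      ≡⟨ *-distribˡ-sum c f ⟨
  c * sum f                ≡⟨ cong (c *_) (sumFin≡sum n f) ⟨
  c * sumFin n f           ∎

sumFin-comm : ∀ m n (f : Fin m → Fin n → ℕ) →
  sumFin m (λ i → sumFin n (f i)) ≡ sumFin n (λ j → sumFin m (λ i → f i j))
sumFin-comm m n f = begin
  sumFin m (λ i → sumFin n (f i))          ≡⟨ nested m n f ⟩
  sum (λ i → sum (f i))                    ≡⟨ ∑-comm f ⟩
  sum (λ j → sum (λ i → f i j))            ≡⟨ nested n m (λ j i → f i j) ⟨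
  sumFin n (λ j → sumFin m (λ i → f i j))  ∎
  where
  nested : ∀ m n (g : Fin m → Fin n → ℕ) → sumFin m (λ i → sumFin n (g i)) ≡ sum (λ i → sum (g i))
  nested m n g = trans (sumFin≡sum m _) (sum-cong-≗ (λ i → sumFin≡sum n (g i)))

sumFin-mono-≤ : ∀ n {f g : Fin n → ℕ} → (∀ i → f i ≤ g i) → sumFin n f ≤ sumFin n g
sumFin-mono-≤ zero    f≤g = z≤n
sumFin-mono-≤ (suc n) f≤g = +-mono-≤ (f≤g Fin.zero) (sumFin-mono-≤ n (f≤g ∘ Fin.suc))

sumFin-mono-< : ∀ n {f g : Fin n → ℕ} → (∀ i → f i ≤ g i) → ∀ i → f i < g i → sumFin n f < sumFin n g
sumFin-mono-< (suc n) f≤g Fin.zero    f<g = +-mono-<-≤ f<g (sumFin-mono-≤ n (f≤g ∘ Fin.suc))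
sumFin-mono-< (suc n) f≤g (Fin.suc i) f<g = +-mono-≤-< (f≤g Fin.zero) (sumFin-mono-< n (f≤g ∘ Fin.suc) i f<g)

sumFin-zero : ∀ n → sumFin n (λ _ → 0) ≡ 0
sumFin-zero zero    = refl
sumFin-zero (suc n) = sumFin-zero n

ind-yes : ∀ {P : Set} (P? : Dec P) → P → ∀ x → ind P? x ≡ x
ind-yes (yes _) _ x = refl
ind-yes (no ¬p) p x = contradiction p ¬p

ind-no : ∀ {P : Set} (P? : Dec P) → ¬ P → ∀ x → ind P? x ≡ 0
ind-no (yes p) ¬p x = contradiction p ¬p
ind-no (no _)  _  x = refl

ind≡ind* : ∀ {P : Set} (P? : Dec P) x → ind P? x ≡ ind P? 1 * x
ind≡ind* (yes _) x = sym (*-identityˡ x)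
ind≡ind* (no _)  x = refl

ind-cong : ∀ {P : Set} (P? : Dec P) {x y} → (P → x ≡ y) → ind P? x ≡ ind P? y
ind-cong (yes p) x≡y = x≡y p
ind-cong (no _)  x≡y = refl

ind-⇔ : ∀ {P Q : Set} (P? : Dec P) (Q? : Dec Q) → (P → Q) → (Q → P) → ∀ x → ind P? x ≡ ind Q? x
ind-⇔ P? (yes q) P→Q Q→P x = ind-yes P? (Q→P q) x
ind-⇔ P? (no ¬q) P→Q Q→P x = ind-no P? (¬q ∘ P→Q) x

δ : Fin n → Fin n → ℕ
δ i k = ind (i Fin.≟ k) 1

δ-suc : (i k : Fin n) → δ (Fin.suc i) (Fin.suc k) ≡ δ i k
δ-suc i k with i Fin.≟ k
... | yes _ = refl
... | no _  = refl

sumFin-δ : ∀ n (i : Fin n) (f : Fin n → ℕ) → sumFin n (λ k → δ i k * f k) ≡ f i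
sumFin-δ (suc n) Fin.zero    f = begin
  1 * f Fin.zero + sumFin n (λ _ → 0) ≡⟨ cong₂ _+_ (*-identityˡ _) (sumFin-zero n) ⟩
  f Fin.zero + 0                      ≡⟨ +-identityʳ _ ⟩
  f Fin.zero                          ∎
sumFin-δ (suc n) (Fin.suc i) f = begin
  sumFin n (λ k → δ (Fin.suc i) (Fin.suc k) * f (Fin.suc k))
    ≡⟨ sumFin-cong n (λ k → cong (_* f (Fin.suc k)) (δ-suc i k)) ⟩
  sumFin n (λ k → δ i k * f (Fin.suc k))
    ≡⟨ sumFin-δ n i (f ∘ Fin.suc) ⟩
  f (Fin.suc i)
    ∎

Σ² : ∀ m n → (Fin m → Fin n → ℕ) → ℕ
Σ² m n h = sumFin m λ i → sumFin n λ j → h i j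

Σ²-cong : ∀ m n {f g : Fin m → Fin n → ℕ} → (∀ i j → f i j ≡ g i j) → Σ² m n f ≡ Σ² m n g
Σ²-cong m n f≗g = sumFin-cong m (λ i → sumFin-cong n (f≗g i))

Σ²-+ : ∀ m n (f g : Fin m → Fin n → ℕ) → Σ² m n (λ i j → f i j + g i j) ≡ Σ² m n f + Σ² m n g
Σ²-+ m n f g = trans (sumFin-cong m (λ i → sumFin-+ n (f i) (g i))) (sumFin-+ m _ _)

Σ²-*ˡ : ∀ m n c (f : Fin m → Fin n → ℕ) → Σ² m n (λ i j → c * f i j) ≡ c * Σ² m n f
Σ²-*ˡ m n c f = trans (sumFin-cong m (λ i → sumFin-*ˡ n c (f i))) (sumFin-*ˡ m c _)

Σ²-product : ∀ m n (f : Fin m → ℕ) (g : Fin n → ℕ) →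
  Σ² m n (λ i j → f i * g j) ≡ sumFin m f * sumFin n g
Σ²-product m n f g = begin
  Σ² m n (λ i j → f i * g j)        ≡⟨ sumFin-cong m (λ i → sumFin-*ˡ n (f i) g) ⟩
  sumFin m (λ i → f i * sumFin n g) ≡⟨ sumFin-cong m (λ i → *-comm (f i) _) ⟩
  sumFin m (λ i → sumFin n g * f i) ≡⟨ sumFin-*ˡ m (sumFin n g) f ⟩
  sumFin n g * sumFin m f           ≡⟨ *-comm _ (sumFin m f) ⟩
  sumFin m f * sumFin n g           ∎

sumFin-Σ²-comm : ∀ m p q (h : Fin m → Fin p → Fin q → ℕ) →
  sumFin m (λ i → Σ² p q (h i)) ≡ Σ² p q (λ k l → sumFin m (λ i → h i k l))
sumFin-Σ²-comm m p q h =
  trans (sumFin-comm m p (λ i k → sumFin q (h i k))) (sumFin-cong p (λ k → sumFin-comm m q (λ i → h i k)))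

Σ²-comm : ∀ m n p q (h : Fin m → Fin n → Fin p → Fin q → ℕ) →
  Σ² m n (λ i j → Σ² p q (h i j)) ≡ Σ² p q (λ k l → Σ² m n (λ i j → h i j k l))
Σ²-comm m n p q h =
  trans (sumFin-cong m (λ i → sumFin-Σ²-comm n p q (h i)))
        (sumFin-Σ²-comm m p q (λ i k l → sumFin n (λ j → h i j k l)))

Σ²-mono-≤ : ∀ m n {f g : Fin m → Fin n → ℕ} → (∀ i j → f i j ≤ g i j) → Σ² m n f ≤ Σ² m n g
Σ²-mono-≤ m n f≤g = sumFin-mono-≤ m (λ i → sumFin-mono-≤ n (f≤g i))

Σ²-mono-< : ∀ m n {f g : Fin m → Fin n → ℕ} → (∀ i j → f i j ≤ g i j) →
  ∀ i j → f i j < g i j → Σ² m n f < Σ² m n g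
Σ²-mono-< m n f≤g i j f<g = sumFin-mono-< m (λ i → sumFin-mono-≤ n (f≤g i)) i (sumFin-mono-< n (f≤g i) j f<g)

Kernel : ℕ → ℕ → Set
Kernel m n = Fin m → Fin n → Fin m → Fin n → ℕ

pairSum : Mat m n → Mat m n → Kernel m n → ℕ
pairSum {m} {n} X Y f = Σ² m n λ i j → Σ² m n λ k l → val (X i j) * val (Y k l) * f i j k l

infixl 6 _⊕_
infixl 7 _⊙_

_⊕_ : Kernel m n → Kernel m n → Kernel m n
(f ⊕ g) i j k l = f i j k l + g i j k l

_⊙_ : ℕ → Kernel m n → Kernel m n
(c ⊙ f) i j k l = c * f i j k l

swap : Kernel m n → Kernel m n
swap f i j k l = f k l i j

rowᴷ : (Fin m → Fin m → ℕ) → Kernel m n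
rowᴷ g i _ k _ = g i k

colᴷ : (Fin n → Fin n → ℕ) → Kernel m n
colᴷ g _ j _ l = g j l

module _ (X Y : Mat m n) where

  pairSum-cong : {f g : Kernel m n} → (∀ i j k l → f i j k l ≡ g i j k l) → pairSum X Y f ≡ pairSum X Y g
  pairSum-cong f≗g =
    Σ²-cong m n (λ i j → Σ²-cong m n (λ k l → cong (val (X i j) * val (Y k l) *_) (f≗g i j k l)))

  pairSum-⊕ : (f g : Kernel m n) → pairSum X Y (f ⊕ g) ≡ pairSum X Y f + pairSum X Y g
  pairSum-⊕ f g = trans
    (Σ²-cong m n (λ i j → trans (Σ²-cong m n (λ k l → *-distribˡ-+ (val (X i j) * val (Y k l)) _ _))
                                (Σ²-+ m n _ _)))
    (Σ²-+ m n _ _)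

  pairSum-⊙ : ∀ c (f : Kernel m n) → pairSum X Y (c ⊙ f) ≡ c * pairSum X Y f
  pairSum-⊙ c f = trans
    (Σ²-cong m n (λ i j → trans (Σ²-cong m n (λ k l → reassoc (val (X i j) * val (Y k l)) c _)) (Σ²-*ˡ m n c _)))
    (Σ²-*ˡ m n c _)
    where
    reassoc : ∀ a c b → a * (c * b) ≡ c * (a * b)
    reassoc = solve-∀

  pairSum-swap : (f : Kernel m n) → pairSum X Y (swap f) ≡ pairSum Y X f
  pairSum-swap f = begin
    pairSum X Y (swap f)
      ≡⟨ Σ²-comm m n m n _ ⟩
    Σ² m n (λ k l → Σ² m n (λ i j → val (X i j) * val (Y k l) * f k l i j))
      ≡⟨ Σ²-cong m n (λ k l → Σ²-cong m n (λ i j → cong (_* f k l i j) (*-comm (val (X i j)) (val (Y k l))))) ⟩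
    pairSum Y X f
      ∎

_ᵀ : Mat m n → Mat n m
(X ᵀ) j i = X i j

pairSum-transpose : (X Y : Mat m n) (f : Kernel m n) → pairSum X Y f ≡ pairSum (X ᵀ) (Y ᵀ) (λ j i l k → f i j k l)
pairSum-transpose {m} {n} X Y f =
  trans (Σ²-cong m n (λ i j → sumFin-comm m n _)) (sumFin-comm m n _)

pairSum-rowKernel : (X Y : Mat m n) (g : Fin m → Fin m → ℕ) →
  pairSum X Y (rowᴷ g) ≡ Σ² m m (λ i k → g i k * (rowSum X i * rowSum Y k))
pairSum-rowKernel {m} {n} X Y g = begin
  pairSum X Y (rowᴷ g)
    ≡⟨ sumFin-cong m (λ i → sumFin-comm n m _) ⟩
  Σ² m m (λ i k → Σ² n n (λ j l → val (X i j) * val (Y k l) * g i k))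
    ≡⟨ Σ²-cong m m (λ i k → Σ²-cong n n (λ j l → *-comm _ (g i k))) ⟩
  Σ² m m (λ i k → Σ² n n (λ j l → g i k * (val (X i j) * val (Y k l))))
    ≡⟨ Σ²-cong m m (λ i k → trans (Σ²-*ˡ n n (g i k) _) (cong (g i k *_) (Σ²-product n n _ _))) ⟩
  Σ² m m (λ i k → g i k * (rowSum X i * rowSum Y k))
    ∎

SameMargins : Mat m n → Mat m n → Set
SameMargins X Y = (∀ i → rowSum X i ≡ rowSum Y i) × (∀ j → colSum X j ≡ colSum Y j)

SameMargins-sym : {X Y : Mat m n} → SameMargins X Y → SameMargins Y X
SameMargins-sym (rows , cols) = (sym ∘ rows) , (sym ∘ cols)

rowKernel-cong : {X X′ Y Y′ : Mat m n} → SameMargins X X′ → SameMargins Y Y′ →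
  (g : Fin m → Fin m → ℕ) → pairSum X Y (rowᴷ g) ≡ pairSum X′ Y′ (rowᴷ g)
rowKernel-cong {m} {X = X} {X′} {Y} {Y′} (rX , _) (rY , _) g = begin
  pairSum X Y (rowᴷ g)
    ≡⟨ pairSum-rowKernel X Y g ⟩
  Σ² m m (λ i k → g i k * (rowSum X i * rowSum Y k))
    ≡⟨ Σ²-cong m m (λ i k → cong (g i k *_) (cong₂ _*_ (rX i) (rY k))) ⟩
  Σ² m m (λ i k → g i k * (rowSum X′ i * rowSum Y′ k))
    ≡⟨ pairSum-rowKernel X′ Y′ g ⟨
  pairSum X′ Y′ (rowᴷ g)
    ∎

colKernel-cong : {X X′ Y Y′ : Mat m n} → SameMargins X X′ → SameMargins Y Y′ →
  (g : Fin n → Fin n → ℕ) → pairSum X Y (colᴷ g) ≡ pairSum X′ Y′ (colᴷ g)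
colKernel-cong {X = X} {X′} {Y} {Y′} (rX , cX) (rY , cY) g = begin
  pairSum X Y (colᴷ g)            ≡⟨ pairSum-transpose X Y _ ⟩
  pairSum (X ᵀ) (Y ᵀ) (rowᴷ g)     ≡⟨ rowKernel-cong {X = X ᵀ} {X′ ᵀ} {Y ᵀ} {Y′ ᵀ} (cX , rX) (cY , rY) g ⟩
  pairSum (X′ ᵀ) (Y′ ᵀ) (rowᴷ g)   ≡⟨ pairSum-transpose X′ Y′ _ ⟨
  pairSum X′ Y′ (colᴷ g)          ∎

marginKernel-cong : {X X′ Y Y′ : Mat m n} → SameMargins X X′ → SameMargins Y Y′ →
  (g : Fin m → Fin m → ℕ) (h : Fin n → Fin n → ℕ) →
  pairSum X Y (rowᴷ g ⊕ colᴷ h) ≡ pairSum X′ Y′ (rowᴷ g ⊕ colᴷ h)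
marginKernel-cong {X = X} {X′} {Y} {Y′} X~X′ Y~Y′ g h = begin
  pairSum X Y (rowᴷ g ⊕ colᴷ h)
    ≡⟨ pairSum-⊕ X Y _ _ ⟩
  pairSum X Y (rowᴷ g) + pairSum X Y (colᴷ h)
    ≡⟨ cong₂ _+_ (rowKernel-cong X~X′ Y~Y′ g) (colKernel-cong X~X′ Y~Y′ h) ⟩
  pairSum X′ Y′ (rowᴷ g) + pairSum X′ Y′ (colᴷ h)
    ≡⟨ pairSum-⊕ X′ Y′ _ _ ⟨
  pairSum X′ Y′ (rowᴷ g ⊕ colᴷ h)
    ∎

-- lt and le use the very decision procedures of ν and σ, so that they unfold there definitionally.
lt : Fin n → Fin n → ℕ
lt i k = ind (i Fin.<? k) 1

le : Fin n → Fin n → ℕ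
le i k = ind (toℕ i <? suc (toℕ k)) 1

w : Fin n → Fin n → ℕ
w i k = lt i k + le i k

data Cmp : Set where
  less equal greater : Cmp

flipCmp : Cmp → Cmp
flipCmp less    = greater
flipCmp equal   = equal
flipCmp greater = less

[<] [≤] [=] [w] : Cmp → ℕ
[<] less = 1
[<] _    = 0
[≤] greater = 0
[≤] _       = 1
[=] equal = 1
[=] _     = 0
[w] c = [<] c + [≤] c

-- Every kernel below sees (i, j, k, l) only through how i compares with k and j with l,
-- so kernel identities reduce to the nine cases of Cmp × Cmp.
record Compared (i k : Fin n) (c : Cmp) : Set where
  field
    lt-ik : lt i k ≡ [<] c
    lt-ki : lt k i ≡ [<] (flipCmp c)
    le-ik : le i k ≡ [≤] c
    le-ki : le k i ≡ [≤] (flipCmp c)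
    δ-ik  : δ i k ≡ [=] c

open Compared

compare : (i k : Fin n) → ∃ (Compared i k)
compare i k with Fin.<-cmp i k
... | tri< i<k i≢k k≮i = less , record
  { lt-ik = ind-yes _ i<k 1
  ; lt-ki = ind-no _ k≮i 1
  ; le-ik = ind-yes _ (m<n⇒m<1+n i<k) 1
  ; le-ki = ind-no _ (<⇒≱ i<k ∘ s≤s⁻¹) 1
  ; δ-ik  = ind-no _ i≢k 1
  }
... | tri≈ i≮k refl _ = equal , record
  { lt-ik = ind-no _ i≮k 1
  ; lt-ki = ind-no _ i≮k 1
  ; le-ik = ind-yes _ (n<1+n _) 1
  ; le-ki = ind-yes _ (n<1+n _) 1
  ; δ-ik  = ind-yes _ refl 1
  }
... | tri> i≮k i≢k k<i = greater , record
  { lt-ik = ind-no _ i≮k 1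
  ; lt-ki = ind-yes _ k<i 1
  ; le-ik = ind-no _ (<⇒≱ k<i ∘ s≤s⁻¹) 1
  ; le-ki = ind-yes _ (m<n⇒m<1+n k<i) 1
  ; δ-ik  = ind-no _ i≢k 1
  }

1ᴷ wᴷ invᴷ δᴷ : Kernel m n
1ᴷ _ _ _ _ = 1
wᴷ i j k l = w i k * w j l
invᴷ i j k l = lt i k * lt l j
δᴷ i j k l = δ i k * δ j l

wᴷ-antisymᶜ : ∀ c d → [w] c * [w] d + 4 ≡ [w] (flipCmp c) * [w] (flipCmp d) + 2 * ([w] c + [w] d)
wᴷ-antisymᶜ less    less    = refl
wᴷ-antisymᶜ less    equal   = refl
wᴷ-antisymᶜ less    greater = refl
wᴷ-antisymᶜ equal   less    = refl
wᴷ-antisymᶜ equal   equal   = refl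
wᴷ-antisymᶜ equal   greater = refl
wᴷ-antisymᶜ greater less    = refl
wᴷ-antisymᶜ greater equal   = refl
wᴷ-antisymᶜ greater greater = refl

wᴷ-antisym : ∀ (i : Fin m) (j : Fin n) k l →
  (wᴷ ⊕ 4 ⊙ 1ᴷ) i j k l ≡ (swap wᴷ ⊕ 2 ⊙ (rowᴷ w ⊕ colᴷ w)) i j k l
wᴷ-antisym i j k l with compare i k | compare j l
... | c , ik | d , jl
  rewrite lt-ik ik | le-ik ik | lt-ki ik | le-ki ik | lt-ik jl | le-ik jl | lt-ki jl | le-ki jl
  = wᴷ-antisymᶜ c d

νᴷ-identityᶜ : ∀ c d →
  [w] c * [w] d + [w] (flipCmp c) * [w] (flipCmp d) + 4 * ([<] c * [<] (flipCmp d) + [<] (flipCmp c) * [<] d)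
    + 2 * ([=] c + [=] d)
  ≡ 4 + 2 * ([=] c * [=] d)
νᴷ-identityᶜ less    less    = refl
νᴷ-identityᶜ less    equal   = refl
νᴷ-identityᶜ less    greater = refl
νᴷ-identityᶜ equal   less    = refl
νᴷ-identityᶜ equal   equal   = refl
νᴷ-identityᶜ equal   greater = refl
νᴷ-identityᶜ greater less    = refl
νᴷ-identityᶜ greater equal   = refl
νᴷ-identityᶜ greater greater = refl

νᴷ-identity : ∀ (i : Fin m) (j : Fin n) k l →
    (wᴷ ⊕ swap wᴷ ⊕ 4 ⊙ (invᴷ ⊕ swap invᴷ) ⊕ 2 ⊙ (rowᴷ δ ⊕ colᴷ δ)) i j k l
  ≡ (4 ⊙ 1ᴷ ⊕ 2 ⊙ δᴷ) i j k l
νᴷ-identity i j k l with compare i k | compare j l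
... | c , ik | d , jl
  rewrite lt-ik ik | le-ik ik | lt-ki ik | le-ki ik | δ-ik ik | lt-ik jl | le-ik jl | lt-ki jl | le-ki jl | δ-ik jl
  = νᴷ-identityᶜ c d

val-idem : ∀ b → val b * val b ≡ val b
val-idem true  = refl
val-idem false = refl

pairSum-δᴷ : (X : Mat m n) → pairSum X X δᴷ ≡ sumFin m (rowSum X)
pairSum-δᴷ {m} {n} X = Σ²-cong m n λ i j → begin
  Σ² m n (λ k l → val (X i j) * val (X k l) * (δ i k * δ j l))
    ≡⟨ sumFin-cong m (λ k → trans (sumFin-cong n (λ l → reorder (val (X i j)) (val (X k l)) (δ i k) (δ j l)))
                                  (sumFin-*ˡ n (δ i k) _)) ⟩
  sumFin m (λ k → δ i k * sumFin n (λ l → δ j l * (val (X i j) * val (X k l))))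
    ≡⟨ sumFin-cong m (λ k → cong (δ i k *_) (sumFin-δ n j _)) ⟩
  sumFin m (λ k → δ i k * (val (X i j) * val (X k j)))
    ≡⟨ sumFin-δ m i _ ⟩
  val (X i j) * val (X i j)
    ≡⟨ val-idem (X i j) ⟩
  val (X i j)
    ∎
  where
  reorder : ∀ a b d e → a * b * (d * e) ≡ d * (e * (a * b))
  reorder = solve-∀

β : Mat m n → Mat m n → ℕ
β X Y = pairSum X Y wᴷ

β-antisym : (X Y : Mat m n) →
  β X Y + 4 * pairSum X Y 1ᴷ ≡ β Y X + 2 * pairSum X Y (rowᴷ w ⊕ colᴷ w)
β-antisym X Y = begin
  β X Y + 4 * pairSum X Y 1ᴷ                    ≡⟨ cong (β X Y +_) (pairSum-⊙ X Y 4 1ᴷ) ⟨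
  β X Y + pairSum X Y (4 ⊙ 1ᴷ)                  ≡⟨ pairSum-⊕ X Y wᴷ (4 ⊙ 1ᴷ) ⟨
  pairSum X Y (wᴷ ⊕ 4 ⊙ 1ᴷ)                     ≡⟨ pairSum-cong X Y wᴷ-antisym ⟩
  pairSum X Y (swap wᴷ ⊕ 2 ⊙ (rowᴷ w ⊕ colᴷ w)) ≡⟨ pairSum-⊕ X Y _ _ ⟩
  pairSum X Y (swap wᴷ) + pairSum X Y (2 ⊙ (rowᴷ w ⊕ colᴷ w))
    ≡⟨ cong₂ _+_ (pairSum-swap X Y wᴷ) (pairSum-⊙ X Y 2 _) ⟩
  β Y X + 2 * pairSum X Y (rowᴷ w ⊕ colᴷ w)     ∎

+-cross-cancel : ∀ {a b r s} → a + r ≡ b + s → b + r ≡ a + s → a ≡ b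
+-cross-cancel {a} {b} {r} {s} a+r≡b+s b+r≡a+s =
  +-cancelʳ-≡ r a b (trans a+r≡b+s (cong (b +_) (sym r≡s)))
  where
  regroup : ∀ x y z → x + z + (y + z) ≡ x + y + 2 * z
  regroup = solve-∀
  r≡s : r ≡ s
  r≡s = *-cancelˡ-≡ r s 2 (+-cancelˡ-≡ (a + b) _ _ (begin
    a + b + 2 * r         ≡⟨ regroup a b r ⟨
    a + r + (b + r)       ≡⟨ cong₂ _+_ a+r≡b+s b+r≡a+s ⟩
    b + s + (a + s)       ≡⟨ regroup b a s ⟩
    b + a + 2 * s         ≡⟨ cong (_+ 2 * s) (+-comm b a) ⟩
    a + b + 2 * s         ∎))

β-sym : {X Y : Mat m n} → SameMargins X Y → β X Y ≡ β Y X
β-sym {X = X} {Y} X~Y = +-cross-cancel (β-antisym X Y) (begin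
  β Y X + 4 * pairSum X Y 1ᴷ                ≡⟨ cong (λ a → β Y X + 4 * a) (rowKernel-cong X~Y Y~X (λ _ _ → 1)) ⟩
  β Y X + 4 * pairSum Y X 1ᴷ                ≡⟨ β-antisym Y X ⟩
  β X Y + 2 * pairSum Y X (rowᴷ w ⊕ colᴷ w) ≡⟨ cong (λ a → β X Y + 2 * a) (marginKernel-cong Y~X X~Y w w) ⟩
  β X Y + 2 * pairSum X Y (rowᴷ w ⊕ colᴷ w) ∎)
  where
  Y~X = SameMargins-sym X~Y

val-both : ∀ a b → val (both a b) ≡ val a * val b
val-both true  true  = refl
val-both true  false = refl
val-both false true  = refl
val-both false false = refl

ν-as-pairSum : (X : Mat m n) → ν X ≡ pairSum X X invᴷ
ν-as-pairSum {m} {n} X = Σ²-cong m n λ i j → Σ²-cong m n λ k l → begin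
  ind (i Fin.<? k) (ind (l Fin.<? j) (val (both (X i j) (X k l))))
    ≡⟨ ind≡ind* (i Fin.<? k) _ ⟩
  lt i k * ind (l Fin.<? j) (val (both (X i j) (X k l)))
    ≡⟨ cong (lt i k *_) (ind≡ind* (l Fin.<? j) _) ⟩
  lt i k * (lt l j * val (both (X i j) (X k l)))
    ≡⟨ cong (λ v → lt i k * (lt l j * v)) (val-both (X i j) (X k l)) ⟩
  lt i k * (lt l j * (val (X i j) * val (X k l)))
    ≡⟨ reorder (lt i k) (lt l j) (val (X i j)) (val (X k l)) ⟩
  val (X i j) * val (X k l) * (lt i k * lt l j)
    ∎
  where
  reorder : ∀ a b c d → a * (b * (c * d)) ≡ c * d * (a * b)
  reorder = solve-∀

-- With row sums r, column sums c and N ones this reads β X X + 4 ν X + Σ rᵢ² + Σ cⱼ² = 2N² + N.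
β-ν-identity : (X : Mat m n) →
  β X X + 4 * ν X + pairSum X X (rowᴷ δ ⊕ colᴷ δ) ≡ 2 * pairSum X X 1ᴷ + pairSum X X δᴷ
β-ν-identity X = *-cancelˡ-≡ _ _ 2 (begin
  2 * (β X X + 4 * ν X + ψ M)
    ≡⟨ double₁ (β X X) (ν X) (ψ M) ⟩
  β X X + β X X + 4 * (ν X + ν X) + 2 * ψ M
    ≡⟨ cong (λ v → β X X + β X X + 4 * (v + v) + 2 * ψ M) (ν-as-pairSum X) ⟩
  β X X + β X X + 4 * (ψ invᴷ + ψ invᴷ) + 2 * ψ M
    ≡⟨ cong₂ (λ a b → β X X + a + 4 * (ψ invᴷ + b) + 2 * ψ M) (pairSum-swap X X wᴷ) (pairSum-swap X X invᴷ) ⟨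
  ψ wᴷ + ψ (swap wᴷ) + 4 * (ψ invᴷ + ψ (swap invᴷ)) + 2 * ψ M
    ≡⟨ cong₂ (λ a b → a + b + 2 * ψ M) (pairSum-⊕ X X _ _)
             (trans (pairSum-⊙ X X 4 _) (cong (4 *_) (pairSum-⊕ X X _ _))) ⟨
  ψ (wᴷ ⊕ swap wᴷ) + ψ (4 ⊙ (invᴷ ⊕ swap invᴷ)) + 2 * ψ M
    ≡⟨ cong₂ _+_ (pairSum-⊕ X X _ _) (pairSum-⊙ X X 2 M) ⟨
  ψ (wᴷ ⊕ swap wᴷ ⊕ 4 ⊙ (invᴷ ⊕ swap invᴷ)) + ψ (2 ⊙ M)
    ≡⟨ pairSum-⊕ X X _ _ ⟨
  ψ (wᴷ ⊕ swap wᴷ ⊕ 4 ⊙ (invᴷ ⊕ swap invᴷ) ⊕ 2 ⊙ M)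
    ≡⟨ pairSum-cong X X νᴷ-identity ⟩
  ψ (4 ⊙ 1ᴷ ⊕ 2 ⊙ δᴷ)
    ≡⟨ trans (pairSum-⊕ X X _ _) (cong₂ _+_ (pairSum-⊙ X X 4 1ᴷ) (pairSum-⊙ X X 2 δᴷ)) ⟩
  4 * ψ 1ᴷ + 2 * ψ δᴷ
    ≡⟨ double₂ (ψ 1ᴷ) (ψ δᴷ) ⟩
  2 * (2 * ψ 1ᴷ + ψ δᴷ)
    ∎)
  where
  ψ = pairSum X X
  M = rowᴷ δ ⊕ colᴷ δ
  double₁ : ∀ b v c → 2 * (b + 4 * v + c) ≡ b + b + 4 * (v + v) + 2 * c
  double₁ = solve-∀
  double₂ : ∀ a d → 4 * a + 2 * d ≡ 2 * (2 * a + d)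
  double₂ = solve-∀

β+4ν-margins : {A C : Mat m n} → SameMargins A C → β A A + 4 * ν A ≡ β C C + 4 * ν C
β+4ν-margins {m} {A = A} {C} A~C = +-cancelʳ-≡ (pairSum A A M) _ _ (begin
  β A A + 4 * ν A + pairSum A A M
    ≡⟨ β-ν-identity A ⟩
  2 * pairSum A A 1ᴷ + pairSum A A δᴷ
    ≡⟨ cong₂ (λ a b → 2 * a + b) (rowKernel-cong A~C A~C (λ _ _ → 1)) diagonal ⟩
  2 * pairSum C C 1ᴷ + pairSum C C δᴷ
    ≡⟨ β-ν-identity C ⟨
  β C C + 4 * ν C + pairSum C C M
    ≡⟨ cong (β C C + 4 * ν C +_) (marginKernel-cong C~A C~A δ δ) ⟩
  β C C + 4 * ν C + pairSum A A M
    ∎)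
  where
  M = rowᴷ δ ⊕ colᴷ δ
  C~A = SameMargins-sym A~C
  diagonal : pairSum A A δᴷ ≡ pairSum C C δᴷ
  diagonal = trans (pairSum-δᴷ A) (trans (sumFin-cong m (proj₁ A~C)) (sym (pairSum-δᴷ C)))

σ-as-Σ² : (X : Mat m n) (a b : ℕ) →
  σ X a b ≡ Σ² m n (λ i j → ind (toℕ i <? a) 1 * (ind (toℕ j <? b) 1 * val (X i j)))
σ-as-Σ² {m} {n} X a b = sumFin-cong m λ i → begin
  ind (toℕ i <? a) (sumUpTo n b (val ∘ X i))
    ≡⟨ ind≡ind* (toℕ i <? a) _ ⟩
  ind (toℕ i <? a) 1 * sumUpTo n b (val ∘ X i)
    ≡⟨ cong (ind (toℕ i <? a) 1 *_) (sumFin-cong n (λ j → ind≡ind* (toℕ j <? b) _)) ⟩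
  ind (toℕ i <? a) 1 * sumFin n (λ j → ind (toℕ j <? b) 1 * val (X i j))
    ≡⟨ sumFin-*ˡ n (ind (toℕ i <? a) 1) _ ⟨
  sumFin n (λ j → ind (toℕ i <? a) 1 * (ind (toℕ j <? b) 1 * val (X i j)))
    ∎

τ : Mat m n → Fin m → Fin n → ℕ
τ X k l = σ X (toℕ k) (toℕ l)       + σ X (toℕ k) (suc (toℕ l))
        + σ X (suc (toℕ k)) (toℕ l) + σ X (suc (toℕ k)) (suc (toℕ l))

τ-as-Σ² : (X : Mat m n) (k : Fin m) (l : Fin n) → Σ² m n (λ i j → val (X i j) * wᴷ i j k l) ≡ τ X k l
τ-as-Σ² {m} {n} X k l = begin
  Σ² m n (λ i j → val (X i j) * wᴷ i j k l)
    ≡⟨ Σ²-cong m n (λ i j → expand (val (X i j)) (lt i k) (le i k) (lt j l) (le j l)) ⟩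
  Σ² m n (λ i j → lt i k * (lt j l * val (X i j)) + lt i k * (le j l * val (X i j))
                 + le i k * (lt j l * val (X i j)) + le i k * (le j l * val (X i j)))
    ≡⟨ trans (Σ²-+ m n _ _) (cong (_+ S k⁺ l⁺) (trans (Σ²-+ m n _ _) (cong (_+ S k⁺ l′) (Σ²-+ m n _ _)))) ⟩
  S k′ l′ + S k′ l⁺ + S k⁺ l′ + S k⁺ l⁺
    ≡⟨ cong₂ _+_ (cong₂ _+_ (cong₂ _+_ (σ-as-Σ² X k′ l′) (σ-as-Σ² X k′ l⁺)) (σ-as-Σ² X k⁺ l′))
                 (σ-as-Σ² X k⁺ l⁺) ⟨
  τ X k l
    ∎
  where
  k′ = toℕ k
  k⁺ = suc (toℕ k)
  l′ = toℕ l
  l⁺ = suc (toℕ l)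
  S : ℕ → ℕ → ℕ
  S a b = Σ² m n (λ i j → ind (toℕ i <? a) 1 * (ind (toℕ j <? b) 1 * val (X i j)))
  expand : ∀ v a₁ a₂ b₁ b₂ → v * ((a₁ + a₂) * (b₁ + b₂))
                            ≡ a₁ * (b₁ * v) + a₁ * (b₂ * v) + a₂ * (b₁ * v) + a₂ * (b₂ * v)
  expand = solve-∀

β-as-τ : (X Y : Mat m n) → β X Y ≡ Σ² m n (λ k l → val (Y k l) * τ X k l)
β-as-τ {m} {n} X Y = begin
  β X Y
    ≡⟨ Σ²-comm m n m n _ ⟩
  Σ² m n (λ k l → Σ² m n (λ i j → val (X i j) * val (Y k l) * wᴷ i j k l))
    ≡⟨ Σ²-cong m n (λ k l → Σ²-cong m n (λ i j → reorder (val (X i j)) (val (Y k l)) (wᴷ i j k l))) ⟩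
  Σ² m n (λ k l → Σ² m n (λ i j → val (Y k l) * (val (X i j) * wᴷ i j k l)))
    ≡⟨ Σ²-cong m n (λ k l → trans (Σ²-*ˡ m n (val (Y k l)) _) (cong (val (Y k l) *_) (τ-as-Σ² X k l))) ⟩
  Σ² m n (λ k l → val (Y k l) * τ X k l)
    ∎
  where
  reorder : ∀ x y c → x * y * c ≡ y * (x * c)
  reorder = solve-∀

module _ {A C : Mat m n} (τ≤ : ∀ k l → τ C k l ≤ τ A k l) where

  β-mono-≤ : (Y : Mat m n) → β C Y ≤ β A Y
  β-mono-≤ Y = subst₂ _≤_ (sym (β-as-τ C Y)) (sym (β-as-τ A Y))
    (Σ²-mono-≤ m n (λ k l → *-monoʳ-≤ (val (Y k l)) (τ≤ k l)))

  β-mono-< : (Y : Mat m n) {i : Fin m} {j : Fin n} → Y i j ≡ true → τ C i j < τ A i j → β C Y < β A Y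
  β-mono-< Y {i} {j} Yij τ< = subst₂ _<_ (sym (β-as-τ C Y)) (sym (β-as-τ A Y))
    (Σ²-mono-< m n (λ k l → *-monoʳ-≤ (val (Y k l)) (τ≤ k l)) i j
      (subst (λ b → val b * τ C i j < val b * τ A i j) (sym Yij) (+-monoˡ-< 0 τ<)))

sumUpTo-suc : ∀ n k (f : Fin (suc n) → ℕ) → sumUpTo (suc n) (suc k) f ≡ f Fin.zero + sumUpTo n k (f ∘ Fin.suc)
sumUpTo-suc n k f = cong (f Fin.zero +_)
  (sumFin-cong n (λ i → ind-⇔ (suc (toℕ i) <? suc k) (toℕ i <? k) s≤s⁻¹ s≤s (f (Fin.suc i))))

sumUpTo-snoc : ∀ n (i : Fin n) (f : Fin n → ℕ) → sumUpTo n (suc (toℕ i)) f ≡ sumUpTo n (toℕ i) f + f i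
sumUpTo-snoc (suc n) Fin.zero f = begin
  sumUpTo (suc n) 1 f                     ≡⟨ sumUpTo-suc n 0 f ⟩
  f Fin.zero + sumUpTo n 0 (f ∘ Fin.suc)  ≡⟨ cong (f Fin.zero +_) (sumFin-zero n) ⟩
  f Fin.zero + 0                          ≡⟨ +-comm (f Fin.zero) 0 ⟩
  0 + f Fin.zero                          ≡⟨ cong (_+ f Fin.zero) (sumFin-zero (suc n)) ⟨
  sumUpTo (suc n) 0 f + f Fin.zero        ∎
sumUpTo-snoc (suc n) (Fin.suc i) f = begin
  sumUpTo (suc n) (suc (suc (toℕ i))) f
    ≡⟨ sumUpTo-suc n (suc (toℕ i)) f ⟩
  f Fin.zero + sumUpTo n (suc (toℕ i)) (f ∘ Fin.suc)
    ≡⟨ cong (f Fin.zero +_) (sumUpTo-snoc n i (f ∘ Fin.suc)) ⟩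
  f Fin.zero + (sumUpTo n (toℕ i) (f ∘ Fin.suc) + f (Fin.suc i))
    ≡⟨ +-assoc (f Fin.zero) _ _ ⟨
  f Fin.zero + sumUpTo n (toℕ i) (f ∘ Fin.suc) + f (Fin.suc i)
    ≡⟨ cong (_+ f (Fin.suc i)) (sumUpTo-suc n (toℕ i) f) ⟨
  sumUpTo (suc n) (suc (toℕ i)) f + f (Fin.suc i)
    ∎

sumUpTo-cong : ∀ n k {f g : Fin n → ℕ} → (∀ i → toℕ i < k → f i ≡ g i) → sumUpTo n k f ≡ sumUpTo n k g
sumUpTo-cong n k f≗g = sumFin-cong n (λ i → ind-cong (toℕ i <? k) (f≗g i))

σ-snoc : (X : Mat m n) (i : Fin m) (j : Fin n) →
  σ X (suc (toℕ i)) (suc (toℕ j)) ≡ σ X (toℕ i) (suc (toℕ j)) + (sumUpTo n (toℕ j) (val ∘ X i) + val (X i j))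
σ-snoc {m} {n} X i j =
  trans (sumUpTo-snoc m i (λ r → sumUpTo n (suc (toℕ j)) (val ∘ X r)))
        (cong (σ X (toℕ i) (suc (toℕ j)) +_) (sumUpTo-snoc n j (val ∘ X i)))

σ-first-difference : (A C : Mat m n) (i : Fin m) (j : Fin n) →
  (∀ r → r Fin.< i → ∀ s → A r s ≡ C r s) → (∀ s → s Fin.< j → A i s ≡ C i s) →
  σ A (suc (toℕ i)) (suc (toℕ j)) + val (C i j) ≡ σ C (suc (toℕ i)) (suc (toℕ j)) + val (A i j)
σ-first-difference {m} {n} A C i j rows-before cols-before = begin
  σ A (suc (toℕ i)) (suc (toℕ j)) + val (C i j)
    ≡⟨ cong (_+ val (C i j)) (σ-snoc A i j) ⟩
  σ A (toℕ i) (suc (toℕ j)) + (sumUpTo n (toℕ j) (val ∘ A i) + val (A i j)) + val (C i j)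
    ≡⟨ cong₂ (λ a b → a + (b + val (A i j)) + val (C i j)) rectangle row-prefix ⟩
  σ C (toℕ i) (suc (toℕ j)) + (sumUpTo n (toℕ j) (val ∘ C i) + val (A i j)) + val (C i j)
    ≡⟨ exchange (σ C (toℕ i) (suc (toℕ j))) (sumUpTo n (toℕ j) (val ∘ C i)) (val (A i j)) (val (C i j)) ⟩
  σ C (toℕ i) (suc (toℕ j)) + (sumUpTo n (toℕ j) (val ∘ C i) + val (C i j)) + val (A i j)
    ≡⟨ cong (_+ val (A i j)) (σ-snoc C i j) ⟨
  σ C (suc (toℕ i)) (suc (toℕ j)) + val (A i j)
    ∎
  where
  rectangle : σ A (toℕ i) (suc (toℕ j)) ≡ σ C (toℕ i) (suc (toℕ j))
  rectangle = sumUpTo-cong m (toℕ i) λ r r<i →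
    sumFin-cong n (λ s → cong (λ b → ind (toℕ s <? suc (toℕ j)) (val b)) (rows-before r r<i s))
  row-prefix : sumUpTo n (toℕ j) (val ∘ A i) ≡ sumUpTo n (toℕ j) (val ∘ C i)
  row-prefix = sumUpTo-cong n (toℕ j) (λ s s<j → cong val (cols-before s s<j))
  exchange : ∀ a b x y → a + (b + x) + y ≡ a + (b + y) + x
  exchange = solve-∀

smallest-counterexample : ∀ {p} {P : Pred (Fin n) p} → Decidable P → ¬ (∀ i → P i) →
  ∃ λ i → ¬ P i × (∀ r → r Fin.< i → P r)
smallest-counterexample {n} {P = P} P? ¬∀P with Fin.¬∀⟶∃¬-smallest n P P? ¬∀P
... | i , ¬Pi , below = i , ¬Pi , λ r r<i →
  subst P (Fin.toℕ-injective (trans (Fin.toℕ-inject (fromℕ< r<i)) (Fin.toℕ-fromℕ< r<i))) (below (fromℕ< r<i))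

first-difference : (A C : Mat m n) → ¬ (∀ i j → A i j ≡ C i j) →
  ∃₂ λ i j → (∀ r → r Fin.< i → ∀ s → A r s ≡ C r s) × (∀ s → s Fin.< j → A i s ≡ C i s)
           × A i j ≢ C i j
first-difference A C A≢C with smallest-counterexample (λ i → Fin.all? (λ j → A i j Bool.≟ C i j)) A≢C
... | i , row-differs , rows-before with smallest-counterexample (λ j → A i j Bool.≟ C i j) row-differs
... | j , Aij≢Cij , cols-before = i , j , rows-before , cols-before , Aij≢Cij

bit-difference : ∀ {a c : Bool} {x y : ℕ} → a ≢ c → x + val c ≡ y + val a → y ≤ x → a ≡ true × y < x
bit-difference {true}  {true}  a≢c _ _ = contradiction refl a≢c
bit-difference {false} {false} a≢c _ _ = contradiction refl a≢c
bit-difference {true}  {false} {x} {y} _ x+0≡y+1 _ =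
  refl , ≤-reflexive (sym (trans (sym (+-identityʳ x)) (trans x+0≡y+1 (+-comm y 1))))
bit-difference {false} {true}  {x} {y} _ x+1≡y+0 y≤x =
  contradiction y≤x (<⇒≱ (≤-reflexive (trans (+-comm 1 x) (trans x+1≡y+0 (+-identityʳ y)))))

module _ {A C : Mat m n} (A⪯C : A ⪯B C) where

  private
    three-corners : ∀ k l → σ C (toℕ k) (toℕ l) + σ C (toℕ k) (suc (toℕ l)) + σ C (suc (toℕ k)) (toℕ l)
                          ≤ σ A (toℕ k) (toℕ l) + σ A (toℕ k) (suc (toℕ l)) + σ A (suc (toℕ k)) (toℕ l)
    three-corners k l =
      +-mono-≤ (+-mono-≤ (A⪯C _ _ (<⇒≤ k<m) (<⇒≤ l<n)) (A⪯C _ _ (<⇒≤ k<m) l<n)) (A⪯C _ _ k<m (<⇒≤ l<n))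
      where
      k<m = Fin.toℕ<n k
      l<n = Fin.toℕ<n l

  τ-mono : ∀ k l → τ C k l ≤ τ A k l
  τ-mono k l = +-mono-≤ (three-corners k l) (A⪯C _ _ (Fin.toℕ<n k) (Fin.toℕ<n l))

  τ-mono-< : ∀ k l → σ C (suc (toℕ k)) (suc (toℕ l)) < σ A (suc (toℕ k)) (suc (toℕ l)) → τ C k l < τ A k l
  τ-mono-< k l = +-mono-≤-< (three-corners k l)

  ⪯B-strict : ¬ (∀ i j → A i j ≡ C i j) → ∃₂ λ i j → A i j ≡ true × τ C i j < τ A i j
  ⪯B-strict A≢C with first-difference A C A≢C
  ... | i , j , rows-before , cols-before , Aij≢Cij
    with bit-difference Aij≢Cij (σ-first-difference A C i j rows-before cols-before)
                        (A⪯C _ _ (Fin.toℕ<n i) (Fin.toℕ<n j))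
  ... | Aij , σ< = i , j , Aij , τ-mono-< i j σ<

  ⪯B⇒β< : SameMargins A C → ¬ (∀ i j → A i j ≡ C i j) → β C C < β A A
  ⪯B⇒β< A~C A≢C with ⪯B-strict A≢C
  ... | i , j , Aij , τ< =
    ≤-<-trans (β-mono-≤ τ-mono C) (≤-<-trans (≤-reflexive (β-sym A~C)) (β-mono-< τ-mono A Aij τ<))

⪯B⇒ν< : {A C : Mat m n} → SameMargins A C → A ⪯B C → ¬ (∀ i j → A i j ≡ C i j) → ν A < ν C
⪯B⇒ν< A~C A⪯C A≢C = ≰⇒> λ νC≤νA →
  <-irrefl (sym (β+4ν-margins A~C)) (+-mono-<-≤ (⪯B⇒β< A⪯C A~C A≢C) (*-monoʳ-≤ 4 νC≤νA))

InA⇒SameMargins : ∀ {n k} {A C : Mat n n} → InA n k A → InA n k C → SameMargins A C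
InA⇒SameMargins (rowsA , colsA) (rowsC , colsC) =
  (λ i → trans (rowsA i) (sym (rowsC i))) , (λ j → trans (colsA j) (sym (colsC j)))

lemma1 : (n t : ℕ) → n ≥ 2 →
    (A C : Mat n n) → InA n 2 A → InA n 2 C →
    ν A ≡ t → ν C ≡ t →
    ¬ (∀ (i j : Fin n) → A i j ≡ C i j) →
    ¬ (A ⪯B C)
lemma1 n t _ A C A∈ C∈ νA≡t νC≡t A≢C A⪯C =
  <-irrefl (trans νA≡t (sym νC≡t)) (⪯B⇒ν< (InA⇒SameMargins A∈ C∈) A⪯C A≢C)
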